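{- For every $\lambda_\oplus$-term $M$, the Taylor support $\mathcal T(M)$ is a clique.
   Context: $\lambda_\oplus$-terms are given by $M,N,P,Q ::= x\mid\lambda x.M\mid MN\mid M\oplus N$ up to renaming of bound variables. Resource terms and monomials: $s,t ::= x\mid\lambda x.s\mid\langle s\rangle\bar t\mid s\oplus\bullet\mid\bullet\oplus s$, $\bar t ::= [t_1,\dots,t_n]$ (finite multisets of resource terms); a resource expression is a resource term or monomial. The Taylor support is defined inductively by $\mathcal T(x)=\{x\}$, $\mathcal T(\lambda x.N)=\{\lambda x.t\mid t\in\mathcal T(N)\}$, $\mathcal T(PQ)=\{\langle s\rangle[t_1,\dots,t_n]\mid n\ge0,\ s\in\mathcal T(P),\ t_1,\dots,t_n\in\mathcal T(Q)\}$, $\mathcal T(P\oplus Q)=\{s\oplus\bullet\mid s\in\mathcal T(P)\}\cup\{\bullet\oplus t\mid t\in\mathcal T(Q)\}$ (it is the support of the Taylor expansion of $M$). The coherence relation $\asymp$ on resource expressions is defined inductively: $x\asymp x$; $\lambda x.s\asymp\lambda x.s'$ if $s\asymp s'$; $\langle s\rangle\bar t\asymp\langle s'\rangle\bar t'$ if $s\asymp s'$ and $\bar t\asymp\bar t'$; $[t_1,\dots,t_n]\asymp[t_{n+1},\dots,t_{n+m}]$ if $t_i\asymp t_j$ for all $1\le i,j\le n+m$; $s\oplus\bullet\asymp s'\oplus\bullet$ and $\bullet\oplus s\asymp\bullet\oplus s'$ if $s\asymp s'$; and $s\oplus\bullet\asymp\bullet\oplus s'$ for all $s,s'$ (the relation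 is symmetric). A clique is a set $E$ of resource expressions such that $e\asymp e'$ for all $e,e'\in E$. -}

module Defs where

open import Data.Nat using (ℕ)
open import Data.List using (List; [])
open import Data.List.Membership.Propositional using (_∈_)
open import Data.List.Relation.Unary.All using (All)
open import Data.Sum using (_⊎_)

-- λ⊕-terms, with de Bruijn indices (terms up to renaming of bound variables).
data Term : Set where
  var  : ℕ → Term
  lam  : Term → Term
  app  : Term → Term → Term
  _⊕_  : Term → Term → Term

-- Resource terms; monomials (finite multisets) are represented by lists,
-- all notions below being invariant under permutation.
data RTerm : Set where
  rvar : ℕ → RTerm
  rlam : RTerm → RTerm
  rapp : RTerm → List RTerm → RTerm
  _⊕•  : RTerm → RTerm
  •⊕_  : RTerm → RTerm

Monomial : Set
Monomial = List RTerm

-- Taylor support, as a predicate: TS M s  means  s ∈ 𝒯(M).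
data TS : Term → RTerm → Set where
  ts-var : ∀ {x} → TS (var x) (rvar x)
  ts-lam : ∀ {N t} → TS N t → TS (lam N) (rlam t)
  ts-app : ∀ {P Q s} {ts : List RTerm} → TS P s → All (TS Q) ts → TS (app P Q) (rapp s ts)
  ts-l   : ∀ {P Q s} → TS P s → TS (P ⊕ Q) (s ⊕•)
  ts-r   : ∀ {P Q t} → TS Q t → TS (P ⊕ Q) (•⊕ t)

mutual
  data _≍_ : RTerm → RTerm → Set where
    coh-var : ∀ {x} → rvar x ≍ rvar x
    coh-lam : ∀ {s s'} → s ≍ s' → rlam s ≍ rlam s'
    coh-app : ∀ {s s' ts ts'} → s ≍ s' → ts ≍ₘ ts' → rapp s ts ≍ rapp s' ts'
    coh-ll  : ∀ {s s'} → s ≍ s' → (s ⊕•) ≍ (s' ⊕•)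
    coh-rr  : ∀ {s s'} → s ≍ s' → (•⊕ s) ≍ (•⊕ s')
    coh-lr  : ∀ {s s'} → (s ⊕•) ≍ (•⊕ s')
    coh-rl  : ∀ {s s'} → (•⊕ s) ≍ (s' ⊕•)

  data _≍ₘ_ : Monomial → Monomial → Set where
    coh-mon : ∀ {ts ts'} →
      (∀ {t u} → (t ∈ ts ⊎ t ∈ ts') → (u ∈ ts ⊎ u ∈ ts') → t ≍ u) → ts ≍ₘ ts'

IsClique : (RTerm → Set) → Set
IsClique E = ∀ {e e'} → E e → E e' → e ≍ e'

module Submission where

-- The only non-trivial case is an application P Q: the heads
-- are coherent by induction on P, while the two argument monomials are
-- drawn from the clique 𝒯(Q).

open import Defs
open import Data.List.Membership.Propositional using (_∈_)
open import Data.List.Relation.Unary.All using (All; lookup)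
open import Data.Sum using (_⊎_; inj₁; inj₂)

unionMember : ∀ {E : RTerm → Set} {ts ts' : Monomial} {t : RTerm} →
              All E ts → All E ts' → t ∈ ts ⊎ t ∈ ts' → E t
unionMember all-ts all-ts' (inj₁ t∈ts)  = lookup all-ts t∈ts
unionMember all-ts all-ts' (inj₂ t∈ts') = lookup all-ts' t∈ts'

cliqueMonomialsCoherent : ∀ {E : RTerm → Set} {ts ts' : Monomial} →
                          IsClique E → All E ts → All E ts' → ts ≍ₘ ts'
cliqueMonomialsCoherent clique all-ts all-ts' =
  coh-mon λ t∈ u∈ → clique (unionMember all-ts all-ts' t∈)
                           (unionMember all-ts all-ts' u∈)

theorem4p3 : (M : Term) → IsClique (TS M)
theorem4p3 (var x) ts-var ts-var = coh-var
theorem4p3 (lam N) (ts-lam s) (ts-lam s') = coh-lam (theorem4p3 N s s')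
theorem4p3 (app P Q) (ts-app s ts) (ts-app s' ts') =
  coh-app (theorem4p3 P s s') (cliqueMonomialsCoherent (theorem4p3 Q) ts ts')
theorem4p3 (P ⊕ Q) (ts-l s) (ts-l s') = coh-ll (theorem4p3 P s s')
theorem4p3 (P ⊕ Q) (ts-l s) (ts-r t) = coh-lr
theorem4p3 (P ⊕ Q) (ts-r t) (ts-l s) = coh-rl
theorem4p3 (P ⊕ Q) (ts-r t) (ts-r t') = coh-rr (theorem4p3 Q t t')
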